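{- White has a winning strategy in Multimove Chess $(3,1)$.
   Context: For positive integers $i,j$, Multimove Chess $(i,j)$ is the game played with exactly the rules of standard chess (standard starting position, standard piece moves, White plays first), except that on each of its turns White makes $i$ consecutive moves and on each of its turns Black makes $j$ consecutive moves. A side wins when it captures the opponent's king. A side "has a winning strategy" if it has a strategy guaranteed to win regardless of the opponent's play. -}

module Defs where

-- A model of Multimove Chess (i , j): standard chess rules, king-capture win
-- condition, White makes i consecutive moves per turn, Black makes j.

open import Data.Bool using (Bool; true; false; if_then_else_; _∧_; _∨_; not; T)
open import Data.Nat using (ℕ; zero; suc; _<?_)
open import Data.Fin using (Fin; zero; suc; toℕ; fromℕ<; inject₁; #_)
open import Data.Fin.Properties using () renaming (_≟_ to _≟F_)
open import Data.Maybe using (Maybe; just; nothing; _>>=_)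
open import Data.List using (List; []; _∷_; _++_; concatMap; map; allFin)
open import Data.Bool.ListAction using (any)
open import Data.List.Relation.Unary.All using (All)
open import Data.List.Relation.Unary.Any using (Any)
open import Data.Product using (_×_; _,_; proj₁; proj₂)
open import Relation.Nullary using (yes; no; does)
open import Relation.Binary.PropositionalEquality using (_≡_; _≢_)

data Colour : Set where
  white black : Colour

opp : Colour → Colour
opp white = black
opp black = white

sameColour : Colour → Colour → Bool
sameColour white white = true
sameColour black black = true
sameColour _     _     = false

data Kind : Set where
  pawn knight bishop rook queen king : Kind

isKing : Kind → Bool
isKing king = true
isKing _    = false

isPawn : Kind → Bool
isPawn pawn = true
isPawn _    = false

isRook : Kind → Bool
isRook rook = true
isRook _    = false

record Piece : Set where
  constructor piece
  field
    colour : Colour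
    kind   : Kind
open Piece public

-- Squares and boards.  A square is (file , rank), files a..h = 0..7,
-- ranks 1..8 = 0..7 (rank 0 is White's back rank).

Square : Set
Square = Fin 8 × Fin 8

_≟sq_ : Square → Square → Bool
(f , r) ≟sq (f' , r') = does (f ≟F f') ∧ does (r ≟F r')

allSquares : List Square
allSquares = concatMap (λ f → map (λ r → (f , r)) (allFin 8)) (allFin 8)

Board : Set
Board = Square → Maybe Piece

update : Square → Maybe Piece → Board → Board
update s m b t = if t ≟sq s then m else b t

isEmpty : Board → Square → Bool
isEmpty b s with b s
... | nothing = true
... | just _  = false

hasColour : Colour → Board → Square → Bool
hasColour c b s with b s
... | nothing = false
... | just p  = sameColour (colour p) c

hasPiece : Colour → (Kind → Bool) → Board → Square → Bool
hasPiece c k b s with b s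
... | nothing = false
... | just p  = sameColour (colour p) c ∧ k (kind p)

hasKing : Colour → Board → Bool
hasKing c b = any (hasPiece c isKing b) allSquares

backRank : ℕ → Kind
backRank 0 = rook
backRank 1 = knight
backRank 2 = bishop
backRank 3 = queen
backRank 4 = king
backRank 5 = bishop
backRank 6 = knight
backRank _ = rook

initRank : ℕ → Fin 8 → Maybe Piece
initRank 0 f = just (piece white (backRank (toℕ f)))
initRank 1 f = just (piece white pawn)
initRank 6 f = just (piece black pawn)
initRank 7 f = just (piece black (backRank (toℕ f)))
initRank _ f = nothing

initialBoard : Board
initialBoard (f , r) = initRank (toℕ r) f

record Castling : Set where
  constructor castling
  field
    wK wQ bK bQ : Bool
open Castling public

record State : Set where
  constructor mkState
  field
    board     : Board
    toMove    : Colour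
    movesLeft : ℕ            -- moves the side to move still makes this turn
    rights    : Castling
    epTarget  : Maybe Square -- square passed over by a double pawn push made
                             -- on the immediately preceding move
open State public

movesPerTurn : ℕ → ℕ → Colour → ℕ
movesPerTurn i j white = i
movesPerTurn i j black = j

initialState : ℕ → State
initialState i = mkState initialBoard white i (castling true true true true) nothing

inc : Fin 8 → Maybe (Fin 8)
inc x with suc (toℕ x) <? 8
... | yes p = just (fromℕ< p)
... | no  _ = nothing

dec : Fin 8 → Maybe (Fin 8)
dec zero    = nothing
dec (suc x) = just (inject₁ x)

data Dir : Set where
  N S E W NE NW SE SW : Dir

step : Dir → Square → Maybe Square
step N  (f , r) = inc r >>= λ r' → just (f , r')
step S  (f , r) = dec r >>= λ r' → just (f , r')
step E  (f , r) = inc f >>= λ f' → just (f' , r)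
step W  (f , r) = dec f >>= λ f' → just (f' , r)
step NE (f , r) = inc f >>= λ f' → inc r >>= λ r' → just (f' , r')
step NW (f , r) = dec f >>= λ f' → inc r >>= λ r' → just (f' , r')
step SE (f , r) = inc f >>= λ f' → dec r >>= λ r' → just (f' , r')
step SW (f , r) = dec f >>= λ f' → dec r >>= λ r' → just (f' , r')

rookDirs bishopDirs queenDirs : List Dir
rookDirs   = N ∷ S ∷ E ∷ W ∷ []
bishopDirs = NE ∷ NW ∷ SE ∷ SW ∷ []
queenDirs  = rookDirs ++ bishopDirs

maybeToList : {A : Set} → Maybe A → List A
maybeToList nothing  = []
maybeToList (just x) = x ∷ []

knightTargets : Square → List Square
knightTargets s = concatMap (λ { (d₁ , d₂) → maybeToList (step d₁ s >>= step d₂) })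
  ((N , NE) ∷ (N , NW) ∷ (S , SE) ∷ (S , SW) ∷
   (E , NE) ∷ (E , SE) ∷ (W , NW) ∷ (W , SW) ∷ [])

kingTargets : Square → List Square
kingTargets s = concatMap (λ d → maybeToList (step d s)) queenDirs

slide : Board → Colour → ℕ → Dir → Square → List Square
slide b c zero    d s = []
slide b c (suc n) d s = go (step d s)
  where
  go : Maybe Square → List Square
  go nothing  = []
  go (just t) with b t
  ... | nothing = t ∷ slide b c n d t
  ... | just q  = if sameColour (colour q) c then [] else t ∷ []

slides : Board → Colour → List Dir → Square → List Square
slides b c ds s = concatMap (λ d → slide b c 7 d s) ds

notOwn : Board → Colour → List Square → List Square
notOwn b c [] = []
notOwn b c (t ∷ ts) = if hasColour c b t then notOwn b c ts else t ∷ notOwn b c ts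

Outcome : Set
Outcome = Board × Castling × Maybe Square

-- moving a piece from or to one of these squares loses the relevant right
touch : Square → Castling → Castling
touch s (castling wk wq bk bq) =
  castling (wk ∧ not (s ≟sq (# 4 , # 0)) ∧ not (s ≟sq (# 7 , # 0)))
           (wq ∧ not (s ≟sq (# 4 , # 0)) ∧ not (s ≟sq (# 0 , # 0)))
           (bk ∧ not (s ≟sq (# 4 , # 7)) ∧ not (s ≟sq (# 7 , # 7)))
           (bq ∧ not (s ≟sq (# 4 , # 7)) ∧ not (s ≟sq (# 0 , # 7)))

plain : Board → Castling → Square → Square → Piece → Outcome
plain b cr s t q = update t (just q) (update s nothing b) , touch t (touch s cr) , nothing

startRank lastRank : Colour → ℕ
startRank white = 1
startRank black = 6
lastRank  white = 7
lastRank  black = 0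

forward : Colour → Dir
forward white = N
forward black = S

diagonals : Colour → List Dir
diagonals white = NE ∷ NW ∷ []
diagonals black = SE ∷ SW ∷ []

rankIs : ℕ → Square → Bool
rankIs n (f , r) = does (toℕ r Data.Nat.≟ n)

pawnArrive : Board → Castling → Colour → Square → Square → List Outcome
pawnArrive b cr c s t =
  if rankIs (lastRank c) t
  then map (λ k → plain b cr s t (piece c k)) (queen ∷ rook ∷ bishop ∷ knight ∷ [])
  else plain b cr s t (piece c pawn) ∷ []

isJust≡ : Maybe Square → Square → Bool
isJust≡ nothing  t = false
isJust≡ (just u) t = u ≟sq t

pawnMoves : Board → Castling → Maybe Square → Colour → Square → List Outcome
pawnMoves b cr ep c s = pushes (step (forward c) s) ++ concatMap capture (diagonals c)
  where
  double : Square → Maybe Square → List Outcome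
  double t nothing   = []
  double t (just u)  =
    if rankIs (startRank c) s ∧ isEmpty b u
    then (update u (just (piece c pawn)) (update s nothing b) , touch u (touch s cr) , just t) ∷ []
    else []
  pushes : Maybe Square → List Outcome
  pushes nothing  = []
  pushes (just t) =
    if isEmpty b t then pawnArrive b cr c s t ++ double t (step (forward c) t) else []
  epCap : Square → List Outcome
  epCap t =
    let victim = (proj₁ t , proj₂ s) in
    if isJust≡ ep t ∧ isEmpty b t ∧ hasPiece (opp c) isPawn b victim
    then (update t (just (piece c pawn)) (update victim nothing (update s nothing b)) ,
          touch t (touch s cr) , nothing) ∷ []
    else []
  capTo : Maybe Square → List Outcome
  capTo nothing  = []
  capTo (just t) = if hasColour (opp c) b t then pawnArrive b cr c s t else epCap t
  capture : Dir → List Outcome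
  capture d = capTo (step d s)

castleMoves : Board → Castling → Colour → Square → List Outcome
castleMoves b cr c s = kside ++ qside
  where
  r : Fin 8
  r = if sameColour c white then # 0 else # 7
  right-k right-q : Bool
  right-k = if sameColour c white then wK cr else bK cr
  right-q = if sameColour c white then wQ cr else bQ cr
  atHome : Bool
  atHome = s ≟sq (# 4 , r)
  castle : Square → Square → Square → Square → Outcome
  castle kTo rFrom rTo _ =
    update kTo (just (piece c king)) (update rTo (just (piece c rook))
      (update s nothing (update rFrom nothing b))) ,
    touch rFrom (touch s cr) , nothing
  kside qside : List Outcome
  kside = if right-k ∧ atHome ∧ isEmpty b (# 5 , r) ∧ isEmpty b (# 6 , r)
             ∧ hasPiece c isRook b (# 7 , r)
          then castle (# 6 , r) (# 7 , r) (# 5 , r) s ∷ [] else []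
  qside = if right-q ∧ atHome ∧ isEmpty b (# 1 , r) ∧ isEmpty b (# 2 , r)
             ∧ isEmpty b (# 3 , r) ∧ hasPiece c isRook b (# 0 , r)
          then castle (# 2 , r) (# 0 , r) (# 3 , r) s ∷ [] else []

pieceMoves : Board → Castling → Maybe Square → Square → Piece → List Outcome
pieceMoves b cr ep s (piece c pawn)   = pawnMoves b cr ep c s
pieceMoves b cr ep s (piece c knight) = map (λ t → plain b cr s t (piece c knight)) (notOwn b c (knightTargets s))
pieceMoves b cr ep s (piece c bishop) = map (λ t → plain b cr s t (piece c bishop)) (slides b c bishopDirs s)
pieceMoves b cr ep s (piece c rook)   = map (λ t → plain b cr s t (piece c rook)) (slides b c rookDirs s)
pieceMoves b cr ep s (piece c queen)  = map (λ t → plain b cr s t (piece c queen)) (slides b c queenDirs s)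
pieceMoves b cr ep s (piece c king)   =
  map (λ t → plain b cr s t (piece c king)) (notOwn b c (kingTargets s)) ++ castleMoves b cr c s

outcomes : State → List Outcome
outcomes st = concatMap from allSquares
  where
  from : Square → List Outcome
  from s with board st s
  ... | nothing = []
  ... | just p  = if sameColour (colour p) (toMove st)
                  then pieceMoves (board st) (rights st) (epTarget st) s p else []

afterMove : ℕ → ℕ → State → Outcome → State
afterMove i j st (b , cr , ep) = next (movesLeft st)
  where
  next : ℕ → State
  next (suc (suc k)) = mkState b (toMove st) (suc k) cr ep
  next _             = mkState b (opp (toMove st)) (movesPerTurn i j (opp (toMove st))) cr ep

gameOver : State → Bool
gameOver st = not (hasKing white (board st) ∧ hasKing black (board st))

successors : ℕ → ℕ → State → List State
successors i j st = if gameOver st then [] else map (afterMove i j st) (outcomes st)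

-- Forced win for White (least fixed point = White has a strategy that wins
-- against every Black play in finitely many moves).

data WhiteWins (i j : ℕ) : State → Set where
  blackKingCaptured : ∀ {st} → T (hasKing white (board st)) →
                      T (not (hasKing black (board st))) → WhiteWins i j st
  whiteToMove : ∀ {st} → toMove st ≡ white →
                Any (WhiteWins i j) (successors i j st) → WhiteWins i j st
  blackToMove : ∀ {st} → toMove st ≡ black → successors i j st ≢ [] →
                All (WhiteWins i j) (successors i j st) → WhiteWins i j st

WhiteHasWinningStrategy : ℕ → ℕ → Set
WhiteHasWinningStrategy i j = WhiteWins i j (initialState i)

module Submission where

-- The black king is walled in on e8 and can only be freed by a pawn move, so a
-- single Black move can never get it off e8.  White therefore develops the
-- knight to c3 (padding the turn with a3 and Ra2, since a knight reaching c7 at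
-- once would be taken by the queen), lets Black make its one move, and then
-- plays Nd5, Nc7 and Nxe8 in one turn.

open import Defs
open import Data.Bool using (Bool; true; false; _∧_; not; T)
open import Data.Bool.Properties using (T-∧)
open import Data.Bool.ListAction using (any; all)
open import Data.Nat using (ℕ)
open import Data.Fin using (#_)
open import Data.Product using (_×_; _,_; proj₁; proj₂)
open import Data.List using (List; []; _∷_; null)
open import Data.List.Relation.Unary.Any as Any using (Any)
open import Data.List.Relation.Unary.Any.Properties using (any⁻)
open import Data.List.Relation.Unary.All as All using (All)
open import Data.List.Relation.Unary.All.Properties using (all⁺)
open import Function.Bundles using (Equivalence)
open import Relation.Binary.PropositionalEquality using (_≡_; _≢_; refl)

T-∧⁻ : ∀ {x y} → T (x ∧ y) → T x × T y
T-∧⁻ = Equivalence.to T-∧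

sameColour-white : ∀ c → T (sameColour c white) → c ≡ white
sameColour-white white _ = refl

sameColour-black : ∀ c → T (sameColour c black) → c ≡ black
sameColour-black black _ = refl

¬null⇒≢[] : {A : Set} (xs : List A) → T (not (null xs)) → xs ≢ []
¬null⇒≢[] (_ ∷ _) _ ()

-- The test in a play step only prunes the search: the checker accepts if some
-- White move passing the test leads to a position where the rest succeeds.
data Plan : Set where
  kingCaptured : Plan
  play         : (State → Bool) → Plan → Plan
  reply        : Plan → Plan

module _ (i j : ℕ) where

  achieves : Plan → State → Bool
  achieves kingCaptured st = hasKing white (board st) ∧ not (hasKing black (board st))
  achieves (play goal plan) st =
    sameColour (toMove st) white ∧ any (λ st′ → goal st′ ∧ achieves plan st′) (successors i j st)
  achieves (reply plan) st =
    sameColour (toMove st) black ∧ not (null (successors i j st)) ∧ all (achieves plan) (successors i j st)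

  achieves-sound : ∀ plan st → T (achieves plan st) → WhiteWins i j st
  achieves-sound kingCaptured st h = blackKingCaptured (proj₁ (T-∧⁻ h)) (proj₂ (T-∧⁻ h))
  achieves-sound (play goal plan) st h with T-∧⁻ h
  ... | whiteMoves , chosen =
    whiteToMove (sameColour-white (toMove st) whiteMoves)
      (Any.map (λ {st′} g → achieves-sound plan st′ (proj₂ (T-∧⁻ {goal st′} g)))
               (any⁻ _ (successors i j st) chosen))
  achieves-sound (reply plan) st h with T-∧⁻ h
  ... | blackMoves , nonEmpty∧all with T-∧⁻ nonEmpty∧all
  ... | nonEmpty , allWin =
    blackToMove (sameColour-black (toMove st) blackMoves)
      (¬null⇒≢[] (successors i j st) nonEmpty)
      (All.map (achieves-sound plan _) (all⁺ _ (successors i j st) allWin))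

isKnight : Kind → Bool
isKnight knight = true
isKnight _      = false

whiteOn : (Kind → Bool) → Square → State → Bool
whiteOn kind square st = hasPiece white kind (board st) square

blackKingGone : State → Bool
blackKingGone st = not (hasKing black (board st))

knightRaid : Plan
knightRaid =
  play (whiteOn isPawn   (# 0 , # 2)) (
  play (whiteOn isRook   (# 0 , # 1)) (
  play (whiteOn isKnight (# 2 , # 2)) (
  reply (
  play (whiteOn isKnight (# 3 , # 4)) (
  play (whiteOn isKnight (# 2 , # 6)) (
  play blackKingGone
  kingCaptured))))))

lemma3 : WhiteHasWinningStrategy 3 1
lemma3 = achieves-sound 3 1 knightRaid (initialState 3) _
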